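{- Let $k\ge 2$. The edge polytope $\mathcal{P}(G)$ of a bipartite graph $G$ with at least $k$ edges is $k$-neighborly if and only if $G$ contains no cycle of length $4,6,\dots,2k$ (i.e. $G$ is $\mathcal{C}^{\mathrm{even}}_{2k}$-free).
   Context: All graphs are finite, undirected, without loops, multiple edges or isolated vertices. For a graph $G$ on vertex set $[n]$, the edge polytope is $\mathcal{P}(G)=\mathrm{conv}\{e_i+e_j : \{i,j\}\in E(G)\}\subseteq\mathbb{R}^n$. A polytope $P$ is $k$-neighborly if every subset of at most $k$ of its vertices is the vertex set of a face of $P$. $\mathcal{C}^{\mathrm{even}}_{2k}=\{C_4,C_6,\dots,C_{2k}\}$ is the family of even cycles of length at most $2k$. -}

module Defs where

open import Data.Nat using (ℕ; zero; suc; _<ᵇ_)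
open import Data.Bool using (Bool; true; false; if_then_else_; _∧_)
open import Data.Fin using (Fin; zero; suc; toℕ; inject₁; fromℕ; _≟_)
open import Data.Integer using (ℤ; _+_; _<_; 0ℤ; 1ℤ)
open import Data.List using (List; allFin; cartesianProduct; filterᵇ)
open import Data.List.Membership.Propositional using (_∈_; _∉_)
open import Data.Product using (Σ; ∃; _×_; _,_)
open import Data.Empty using (⊥)
import Data.List.Relation.Unary.Unique.Propositional
import Data.List.Relation.Unary.All
open import Function.Definitions using (Injective)
open import Relation.Binary.PropositionalEquality using (_≡_; _≢_)
open import Relation.Nullary.Decidable using (⌊_⌋)

record Graph (n : ℕ) : Set where
  field
    adj    : Fin n → Fin n → Bool
    symm   : ∀ i j → adj i j ≡ adj j i
    irrefl : ∀ i → adj i i ≡ false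
open Graph public

NoIsolated : ∀ {n} → Graph n → Set
NoIsolated {n} G = ∀ (i : Fin n) → ∃ λ (j : Fin n) → adj G i j ≡ true

Bipartite : ∀ {n} → Graph n → Set
Bipartite {n} G = Σ (Fin n → Bool) λ col →
  ∀ i j → adj G i j ≡ true → col i ≢ col j

edges : ∀ {n} → Graph n → List (Fin n × Fin n)
edges {n} G = filterᵇ (λ { (i , j) → (toℕ i <ᵇ toℕ j) ∧ adj G i j })
                      (cartesianProduct (allFin n) (allFin n))

-- Cycle of length m (m ≥ 3 when used): injective cyclic sequence of
-- vertices with consecutive ones adjacent (as a subgraph).
HasCycle : ∀ {n} → Graph n → ℕ → Set
HasCycle G zero = ⊥
HasCycle {n} G (suc m) = Σ (Fin (suc m) → Fin n) λ f →
  Injective _≡_ _≡_ f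
  × (∀ (i : Fin m) → adj G (f (inject₁ i)) (f (suc i)) ≡ true)
  × adj G (f (fromℕ m)) (f zero) ≡ true

EvenCycleFree : ∀ {n} → ℕ → Graph n → Set
EvenCycleFree k G = ∀ (j : ℕ) → 2 Data.Nat.≤ j → j Data.Nat.≤ k →
  HasCycle G (j Data.Nat.+ j) → ⊥

sumℤ : ∀ {n} → (Fin n → ℤ) → ℤ
sumℤ {zero} f = 0ℤ
sumℤ {suc n} f = f zero + sumℤ (λ x → f (suc x))

dot : ∀ {n} → (Fin n → ℤ) → (Fin n → ℤ) → ℤ
dot w v = sumℤ (λ x → w x Data.Integer.* v x)

unit : ∀ {n} → Fin n → Fin n → ℤ
unit i x = if ⌊ x ≟ i ⌋ then 1ℤ else 0ℤ

pt : ∀ {n} → Fin n × Fin n → Fin n → ℤ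
pt (i , j) x = unit i x + unit j x

-- The vertices of P(G) indexed by the edge list S form the vertex set of a
-- face of P(G): there is a supporting hyperplane w·x = c with w·x ≤ c on
-- P(G) whose intersection with the vertex set of P(G) is exactly S.
-- (Integer normals suffice since all vertices are lattice points.)
IsFaceVertexSet : ∀ {n} → Graph n → List (Fin n × Fin n) → Set
IsFaceVertexSet {n} G S = Σ (Fin n → ℤ) λ w → Σ ℤ λ c →
  ∀ e → e ∈ edges G →
    (e ∈ S → dot w (pt e) ≡ c) × (e ∉ S → dot w (pt e) < c)

Neighborly : ∀ {n} → ℕ → Graph n → Set
Neighborly k G = ∀ (S : List (Fin _ × Fin _)) →
  Data.List.Relation.Unary.Unique.Propositional.Unique S →
  Data.List.Relation.Unary.All.All (_∈ edges G) S →
  Data.List.length S Data.Nat.≤ k →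
  IsFaceVertexSet G S

module Submission where

-- Only if: if v₀ v₁ … v₂ⱼ₋₁ is a cycle with j ≤ k, a face containing exactly the j edges
-- v₂ₜv₂ₜ₊₁ would come with a functional w satisfying w(v₂ₜ) + w(v₂ₜ₊₁) = c and
-- w(v₂ₜ₊₁) + w(v₂ₜ₊₂) < c, so t ↦ w(v₂ₜ) would strictly decrease all the way around the cycle.
--
-- If: for a set S of at most k edges, try w = −h on one colour class and w = h on the other,
-- where the height h : V → ℕ is constant along the edges of S and strictly decreases along
-- every other edge oriented away from the first class. These are difference constraints, so
-- Bellman–Ford either produces h or a simple cycle through a strict constraint. Every vertex
-- of such a cycle lies on an edge of S (a strict constraint can neither leave the second
-- class nor enter the first one), so the cycle has length 2j ≤ 2|S| ≤ 2k, and j ≥ 2 because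
-- no strict constraint can be undone by a single step back.

open import Defs
open import Data.Bool as Bool using (Bool; true; false; not; if_then_else_)
open import Data.Bool.Properties using (T-∧; T-≡; not-involutive; not-¬; ¬-not)
open import Data.Empty using (⊥-elim)
open import Data.Fin as Fin using (Fin; zero; suc; toℕ; inject₁; fromℕ; fromℕ<)
open import Data.Fin.Properties
  using (any?; pigeonhole; toℕ<n; toℕ-injective; injective⇒≤; toℕ-inject₁; toℕ-fromℕ;
         toℕ-fromℕ<; fromℕ<-toℕ; fromℕ<-injective)
open import Data.Integer as ℤ using (ℤ; 0ℤ; 1ℤ)
import Data.Integer.Properties as ℤ
open import Algebra.Properties.Semiring.Sum ℤ.+-*-semiring
  using (sum; sum-cong-≗; ∑-distrib-+; sum-replicate-zero)
open import Data.List using (List; length; lookup; map; _++_; applyUpTo; allFin; cartesianProduct)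
open import Data.List.Extrema.Nat using (max; ⊥≤max; xs≤max; argmax-sel)
open import Data.List.Membership.Propositional using (_∈_; _∉_)
open import Data.List.Membership.Propositional.Properties
  using (∈-map⁺; ∈-map⁻; ∈-allFin; ∈-++⁺ˡ; ∈-++⁺ʳ; ∈-filter⁺; ∈-filter⁻; ∈-cartesianProduct⁺;
         ∈-applyUpTo⁺; ∈-applyUpTo⁻)
import Data.List.Membership.DecPropositional as DecMembership
open import Data.List.Properties using (length-++; length-map; length-applyUpTo)
open import Data.List.Relation.Unary.All as All using (All)
import Data.List.Relation.Unary.All.Properties as All
open import Data.List.Relation.Unary.Any using (index)
open import Data.List.Relation.Unary.Any.Properties using (lookup-index)
open import Data.List.Relation.Unary.Unique.Propositional using (Unique)
import Data.List.Relation.Unary.Unique.Propositional.Properties as Unique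
open import Data.Nat using (ℕ; zero; suc; _+_; _≤_; _<_; _<?_; z≤n; s≤s; z<s; s≤s⁻¹; ⌊_/2⌋)
open import Data.Nat.Properties
open import Data.Product using (∃; ∃₂; _×_; _,_; proj₁; proj₂)
import Data.Product.Properties as Product
open import Data.Sum as Sum using (_⊎_; inj₁; inj₂; [_,_])
open import Function using (_∘_; id; Equivalence)
open import Function.Bundles using (_⇔_; mk⇔)
open import Function.Definitions using (Injective)
open import Relation.Binary.Definitions using (Decidable; DecidableEquality; Transitive)
open import Relation.Binary.PropositionalEquality hiding ([_])
open import Relation.Nullary using (yes; no; ¬_; ¬?; contradiction)
open import Relation.Nullary.Decidable using (_×-dec_; _⊎-dec_)

-- Sequences and simple cycles

InjectiveBelow : {A : Set} → (ℕ → A) → ℕ → Set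
InjectiveBelow v n = ∀ {i j} → i < n → j < n → v i ≡ v j → i ≡ j

module _ {A : Set} (_≟_ : DecidableEquality A) (v : ℕ → A) where

  firstRepeat : ∀ n → InjectiveBelow v n
              ⊎ ∃₂ λ a b → a < b × b < n × v a ≡ v b × InjectiveBelow v b
  firstRepeat zero = inj₁ λ ()
  firstRepeat (suc m) with firstRepeat m
  ... | inj₂ (a , b , a<b , b<m , vₐ≡v_b , inj) = inj₂ (a , b , a<b , m≤n⇒m≤1+n b<m , vₐ≡v_b , inj)
  ... | inj₁ inj with anyUpTo? (λ i → v i ≟ v m) m
  ...   | yes (a , a<m , vₐ≡vₘ) = inj₂ (a , m , a<m , ≤-refl , vₐ≡vₘ , inj)
  ...   | no new = inj₁ inj′
    where
      inj′ : InjectiveBelow v (suc m)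
      inj′ {i} {j} (s≤s i≤m) (s≤s j≤m) vᵢ≡vⱼ with m≤n⇒m<n∨m≡n i≤m | m≤n⇒m<n∨m≡n j≤m
      ... | inj₁ i<m  | inj₁ j<m  = inj i<m j<m vᵢ≡vⱼ
      ... | inj₁ i<m  | inj₂ refl = contradiction (i , i<m , vᵢ≡vⱼ) new
      ... | inj₂ refl | inj₁ j<m  = contradiction (j , j<m , sym vᵢ≡vⱼ) new
      ... | inj₂ refl | inj₂ refl = refl

pigeonholeSegment : ∀ {N} (v : ℕ → Fin N) →
  ∃₂ λ a L → 0 < L × a + L ≤ N × v (a + L) ≡ v a × InjectiveBelow v (a + L)
pigeonholeSegment {N} v with firstRepeat Fin._≟_ v (suc N)
... | inj₁ inj with pigeonhole ≤-refl (λ i → v (toℕ i))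
...   | i , j , i<j , vᵢ≡vⱼ = contradiction (inj (toℕ<n i) (toℕ<n j) vᵢ≡vⱼ) (<⇒≢ i<j)
pigeonholeSegment {N} v | inj₂ (a , b , a<b , s≤s b≤N , vₐ≡v_b , inj) with m≤n⇒∃[o]m+o≡n a<b
... | o , refl = a , suc o , z<s , subst (_≤ N) b≡a+L b≤N ,
                 sym (subst (λ b → v a ≡ v b) b≡a+L vₐ≡v_b) ,
                 subst (InjectiveBelow v) b≡a+L inj
  where
    b≡a+L : suc (a + o) ≡ a + suc o
    b≡a+L = sym (+-suc a o)

double-cancel-≤ : ∀ {s t} → s + s ≤ t + t → s ≤ t
double-cancel-≤ s+s≤t+t = ≮⇒≥ λ t<s → <⇒≱ (+-mono-< t<s t<s) s+s≤t+t

double-injective : ∀ {s t} → s + s ≡ t + t → s ≡ t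
double-injective {s} {t} eq = trans (n≡⌊n+n/2⌋ s) (trans (cong ⌊_/2⌋ eq) (sym (n≡⌊n+n/2⌋ t)))

double≢1+double : ∀ s t → s + s ≢ suc (t + t)
double≢1+double s t eq = even≢odd s t (trans (cong (s +_) (+-identityʳ s))
                                             (trans eq (cong (λ u → suc (t + u)) (sym (+-identityʳ t)))))

alternating⇒even : ∀ {L} (c : ℕ → Bool) → (∀ {i} → i < L → c (suc i) ≡ not (c i)) →
                   c L ≡ c 0 → ∃ λ j → L ≡ j + j
alternating⇒even {L} c alternates cL≡c0 with colourAt L ≤-refl
  where
    colourAt : ∀ i → i ≤ L → (∃ λ j → i ≡ j + j × c i ≡ c 0)
                           ⊎ (∃ λ j → i ≡ suc (j + j) × c i ≡ not (c 0))
    colourAt zero    _   = inj₁ (0 , refl , refl)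
    colourAt (suc i) i<L with colourAt i (<⇒≤ i<L)
    ... | inj₁ (j , refl , cᵢ) = inj₂ (j , refl , trans (alternates i<L) (cong not cᵢ))
    ... | inj₂ (j , refl , cᵢ) = inj₁ (suc j , cong suc (sym (+-suc j j)) ,
                                       trans (alternates i<L) (trans (cong not cᵢ) (not-involutive _)))
... | inj₁ (j , L≡j+j , _)  = j , L≡j+j
... | inj₂ (_ , _ , cL≡¬c0) = contradiction (trans (sym cL≡c0) cL≡¬c0) (not-¬ refl)

injectiveBelow⇒≤length : ∀ {A : Set} {L} {xs : List A} (v : ℕ → A) → InjectiveBelow v L →
                         (∀ {i} → i < L → v i ∈ xs) → L ≤ length xs
injectiveBelow⇒≤length {xs = xs} v inj mem = injective⇒≤ {f = position} position-injective
  where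
    position : Fin _ → Fin (length xs)
    position i = index (mem (toℕ<n i))

    position-injective : Injective _≡_ _≡_ position
    position-injective {i} {j} eq = toℕ-injective (inj (toℕ<n i) (toℕ<n j) (begin
      v (toℕ i)              ≡⟨ lookup-index (mem (toℕ<n i)) ⟩
      lookup xs (position i) ≡⟨ cong (lookup xs) eq ⟩
      lookup xs (position j) ≡⟨ lookup-index (mem (toℕ<n j)) ⟨
      v (toℕ j)              ∎))
      where open ≡-Reasoning

descending⇒< : ∀ {A : Set} {_≺_ : A → A → Set} → Transitive _≺_ →
               (a : ℕ → A) → ∀ J → (∀ {t} → t < J → a (suc t) ≺ a t) → 0 < J → a J ≺ a 0
descending⇒< ≺-trans a (suc zero)    desc _ = desc z<s
descending⇒< {_≺_ = _≺_} ≺-trans a (suc (suc J)) desc _ =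
  ≺-trans (desc ≤-refl) (descending⇒< {_≺_ = _≺_} ≺-trans a (suc J) (desc ∘ m<n⇒m<1+n) z<s)

record SimpleCycle {A : Set} (R : A → A → Set) (L : ℕ) : Set where
  field
    vertex   : ℕ → A
    closed   : vertex L ≡ vertex 0
    step     : ∀ {i} → i < L → R (vertex i) (vertex (suc i))
    distinct : InjectiveBelow vertex L

mapCycle : ∀ {A : Set} {R R′ : A → A → Set} {L} →
           (∀ {x y} → R x y → R′ x y) → SimpleCycle R L → SimpleCycle R′ L
mapCycle f C = record { vertex = vertex ; closed = closed ; step = f ∘ step ; distinct = distinct }
  where open SimpleCycle C

segment⇒cycle : ∀ {A : Set} {R : A → A → Set} (u : ℕ → A) {a L} → u (a + L) ≡ u a →
                (∀ {d} → d < a + L → R (u d) (u (suc d))) → InjectiveBelow u (a + L) →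
                SimpleCycle R L
segment⇒cycle {R = R} u {a} {L} closes steps inj = record
  { vertex   = λ i → u (a + i)
  ; closed   = trans closes (cong u (sym (+-identityʳ a)))
  ; step     = λ {i} i<L → subst (R (u (a + i))) (cong u (sym (+-suc a i))) (steps (+-monoʳ-< a i<L))
  ; distinct = λ i<L j<L eq → +-cancelˡ-≡ a _ _ (inj (+-monoʳ-< a i<L) (+-monoʳ-< a j<L) eq)
  }

module _ {A : Set} {R : A → A → Set} {L} (C : SimpleCycle R L) where
  open SimpleCycle C

  incomingStep : ∀ {i} → i < L → ∃ λ j → R (vertex j) (vertex i)
  incomingStep {zero}  0<L with m≤n⇒∃[o]m+o≡n 0<L
  ... | m , 1+m≡L = m , subst (R (vertex m)) (trans (cong vertex 1+m≡L) closed) (step (≤-reflexive 1+m≡L))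
  incomingStep {suc i} i<L = i , step (<-trans (n<1+n i) i<L)

  vertex-2+≢ : 2 < L → ∀ {i} → suc i < L → vertex (2 + i) ≢ vertex i
  vertex-2+≢ 2<L {i} 1+i<L eq with m≤n⇒m<n∨m≡n 1+i<L
  ... | inj₁ 2+i<L = <-irrefl (sym (distinct 2+i<L (<-trans (n<1+n i) 1+i<L) eq)) (m<n+m i z<s)
  ... | inj₂ refl  = <-irrefl (cong (2 +_) (sym i≡0)) 2<L
    where
      i≡0 : i ≡ 0
      i≡0 = sym (distinct (<-trans z<s 2<L) (<-trans (n<1+n i) 1+i<L) (trans (sym closed) eq))

reverseStep : ∀ {A : Set} {R : A → A → Set} (C : SimpleCycle R 2) → ∀ {i} → i < 2 →
              R (SimpleCycle.vertex C (suc i)) (SimpleCycle.vertex C i)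
reverseStep {R = R} C {zero}        _ = subst (R (vertex 1)) closed (step (n<1+n 1))
  where open SimpleCycle C
reverseStep {R = R} C {suc zero}    _ = subst (λ x → R x (vertex 1)) (sym closed) (step z<s)
  where open SimpleCycle C
reverseStep         C {suc (suc _)} (s≤s (s≤s ()))

-- Difference constraints: a potential or a simple cycle through a strict constraint

module Potentials {N : ℕ} {Weak Strict : Fin N → Fin N → Set}
                  (weak? : Decidable Weak) (strict? : Decidable Strict) where

  Arc : Fin N → Fin N → Set
  Arc x y = Weak x y ⊎ Strict x y

  record Potential : Set where
    field
      height   : Fin N → ℕ
      weak-≤   : ∀ {x y} → Weak x y → height y ≤ height x
      strict-< : ∀ {x y} → Strict x y → height y < height x

  record StrictCycle : Set where
    field
      {len}      : ℕ
      cycle      : SimpleCycle Arc len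
      strictStep : ∃ λ i → i < len × Strict (SimpleCycle.vertex cycle i) (SimpleCycle.vertex cycle (suc i))

  gain : (Fin N → ℕ) → Fin N → Fin N → ℕ
  gain h x y with strict? x y | weak? x y
  ... | yes _ | _     = suc (h y)
  ... | no _  | yes _ = h y
  ... | no _  | no _  = 0

  relax : (Fin N → ℕ) → Fin N → ℕ
  relax h x = max (h x) (map (gain h x) (allFin N))

  relax-≥ : ∀ h x → h x ≤ relax h x
  relax-≥ h x = ⊥≤max (h x) (map (gain h x) (allFin N))

  gain≤relax : ∀ h x y → gain h x y ≤ relax h x
  gain≤relax h x y = All.lookup (xs≤max (h x) _) (∈-map⁺ (gain h x) (∈-allFin y))

  weak⇒≤relax : ∀ h {x y} → Weak x y → h y ≤ relax h x
  weak⇒≤relax h {x} {y} w = ≤-trans weak≤gain (gain≤relax h x y)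
    where
      weak≤gain : h y ≤ gain h x y
      weak≤gain with strict? x y | weak? x y
      ... | yes _ | _     = n≤1+n _
      ... | no _  | yes _ = ≤-refl
      ... | no _  | no ¬w = contradiction w ¬w

  strict⇒<relax : ∀ h {x y} → Strict x y → h y < relax h x
  strict⇒<relax h {x} {y} s = ≤-trans strict<gain (gain≤relax h x y)
    where
      strict<gain : h y < gain h x y
      strict<gain with strict? x y
      ... | yes _ = ≤-refl
      ... | no ¬s = contradiction s ¬s

  relax-attained : ∀ h x → relax h x ≤ h x
    ⊎ ∃ λ y → (Weak x y × relax h x ≡ h y) ⊎ (Strict x y × relax h x ≡ suc (h y))
  relax-attained h x with argmax-sel id (h x) (map (gain h x) (allFin N))
  ... | inj₁ eq = inj₁ (≤-reflexive eq)
  ... | inj₂ ∈gains with ∈-map⁻ (gain h x) ∈gains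
  ...   | y , _ , eq with strict? x y | weak? x y
  ...     | yes s | _     = inj₂ (y , inj₂ (s , eq))
  ...     | no _  | yes w = inj₂ (y , inj₁ (w , eq))
  ...     | no _  | no _  = inj₁ (≤-trans (≤-reflexive eq) z≤n)

  -- level t x is the largest number of strict arcs on a walk of at most t arcs starting at x.
  level : ℕ → Fin N → ℕ
  level zero    _ = 0
  level (suc t)   = relax (level t)

  level-mono : ∀ {s t} x → s ≤ t → level s x ≤ level t x
  level-mono {t = zero}  x z≤n = ≤-refl
  level-mono {t = suc t} x s≤1+t with m≤n⇒m<n∨m≡n s≤1+t
  ... | inj₁ (s≤s s≤t) = ≤-trans (level-mono x s≤t) (relax-≥ (level t) x)
  ... | inj₂ refl      = ≤-refl

  record Changed (t : ℕ) (x : Fin N) : Set where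
    constructor changedBy
    field increase : level t x < level (suc t) x

  Link : ℕ → Fin N → Fin N → Set
  Link t x y = (Weak x y × level (2 + t) x ≤ level (1 + t) y) ⊎ Strict x y

  record Step (t : ℕ) (x : Fin N) : Set where
    field
      target  : Fin N
      changed : Changed t target
      link    : Link t x target

  next : ∀ {t x} → Changed (suc t) x → Step t x
  next {t} {x} (changedBy c) with relax-attained (level (suc t)) x
  ... | inj₁ stuck = contradiction stuck (<⇒≱ c)
  ... | inj₂ (y , inj₁ (w , eq)) = record
    { target  = y
    ; changed = changedBy (<-≤-trans (≤-<-trans (weak⇒≤relax (level t) w) c) (≤-reflexive eq))
    ; link    = inj₁ (w , ≤-reflexive eq)
    }
  ... | inj₂ (y , inj₂ (s , eq)) = record
    { target  = y
    ; changed = changedBy (<-≤-trans (strict⇒<relax (level t) s) (s≤s⁻¹ (<-≤-trans c (≤-reflexive eq))))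
    ; link    = inj₂ s
    }

  trace : ∀ t x → Changed t x → ℕ → Fin N
  trace t       x c zero    = x
  trace zero    x c (suc d) = x
  trace (suc t) x c (suc d) = trace t (Step.target (next c)) (Step.changed (next c)) d

  trace-arc : ∀ {t x} (c : Changed t x) {d} → d < t → Arc (trace t x c d) (trace t x c (suc d))
  trace-arc {suc t} c {zero}  _         = Sum.map₁ proj₁ (Step.link (next c))
  trace-arc {suc t} c {suc d} (s≤s d<t) = trace-arc (Step.changed (next c)) d<t

  trace-descends : ∀ d s {x} (c : Changed (d + s) x) →
    (∀ {i} → i < d → ¬ Strict (trace (d + s) x c i) (trace (d + s) x c (suc i))) →
    level (suc (d + s)) x ≤ level (suc s) (trace (d + s) x c d)
  trace-descends zero    s c strictFree = ≤-refl
  trace-descends (suc d) s c strictFree with Step.link (next c)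
  ... | inj₁ (_ , ≤next) = ≤-trans ≤next (trace-descends d s (Step.changed (next c)) (strictFree ∘ s≤s))
  ... | inj₂ strict      = contradiction strict (strictFree z<s)

  -- Levels do not grow along weak links (each read one iteration earlier), so a closed walk of
  -- weak links would give level (1 + t) x ≤ level t x, although x changed at step t.
  closedTrace-¬strictFree : ∀ {t x} (c : Changed t x) a {L} → 0 < L → a + L ≤ t →
    trace t x c (a + L) ≡ trace t x c a →
    ¬ (∀ {i} → i < L → ¬ Strict (trace t x c (a + i)) (trace t x c (a + suc i)))
  closedTrace-¬strictFree {x = x} c zero {L} 0<L L≤t closes strictFree with m≤n⇒∃[o]m+o≡n L≤t
  ... | s , refl = <⇒≱ (Changed.increase c) (begin
    level (suc (L + s)) x               ≤⟨ trace-descends L s c strictFree ⟩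
    level (suc s) (trace (L + s) x c L) ≡⟨ cong (level (suc s)) closes ⟩
    level (suc s) x                     ≤⟨ level-mono x (+-monoˡ-≤ s 0<L) ⟩
    level (L + s) x                     ∎)
    where open ≤-Reasoning
  closedTrace-¬strictFree {suc t} c (suc a) 0<L (s≤s a+L≤t) closes =
    closedTrace-¬strictFree (Step.changed (next c)) a 0<L a+L≤t closes

  potential⊎strictCycle : Potential ⊎ StrictCycle
  potential⊎strictCycle with any? (λ x → level N x <? level (suc N) x)
  ... | no stable = inj₁ record
    { height   = level N
    ; weak-≤   = λ w → ≤-trans (weak⇒≤relax (level N) w) (≮⇒≥ (stable ∘ (_ ,_)))
    ; strict-< = λ s → <-≤-trans (strict⇒<relax (level N) s) (≮⇒≥ (stable ∘ (_ ,_)))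
    }
  ... | yes (x , c) with pigeonholeSegment (trace N x (changedBy c))
  ...   | a , L , 0<L , a+L≤N , closes , inj = inj₂ record { cycle = C ; strictStep = strictStep }
    where
      u : ℕ → Fin N
      u = trace N x (changedBy c)

      C : SimpleCycle Arc L
      C = segment⇒cycle u closes (λ d<a+L → trace-arc (changedBy c) (<-≤-trans d<a+L a+L≤N)) inj

      strictStep : ∃ λ i → i < L × Strict (u (a + i)) (u (a + suc i))
      strictStep with anyUpTo? (λ i → strict? (u (a + i)) (u (a + suc i))) L
      ... | yes found = found
      ... | no none   = contradiction (λ {i} i<L s → none (i , i<L , s))
                                      (closedTrace-¬strictFree (changedBy c) a 0<L a+L≤N closes)

-- The edge polytope

dot≡sum : ∀ {n} (w v : Fin n → ℤ) → dot w v ≡ sum (λ x → w x ℤ.* v x)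
dot≡sum {zero}  w v = refl
dot≡sum {suc n} w v = cong (ℤ._+_ (w zero ℤ.* v zero)) (dot≡sum (λ x → w (suc x)) (λ x → v (suc x)))

unit-suc : ∀ {n} (i x : Fin n) → unit (suc i) (suc x) ≡ unit i x
unit-suc i x with x Fin.≟ i
... | yes _ = refl
... | no _  = refl

sum-unit : ∀ {n} (w : Fin n → ℤ) i → sum (λ x → w x ℤ.* unit i x) ≡ w i
sum-unit {suc n} w zero = begin
  w zero ℤ.* 1ℤ ℤ.+ sum (λ x → w (suc x) ℤ.* 0ℤ)
    ≡⟨ cong₂ ℤ._+_ (ℤ.*-identityʳ (w zero)) (sum-cong-≗ (λ x → ℤ.*-zeroʳ (w (suc x)))) ⟩
  w zero ℤ.+ sum {n} (λ _ → 0ℤ) ≡⟨ cong (ℤ._+_ (w zero)) (sum-replicate-zero n) ⟩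
  w zero ℤ.+ 0ℤ                 ≡⟨ ℤ.+-identityʳ (w zero) ⟩
  w zero                        ∎
  where open ≡-Reasoning
sum-unit {suc n} w (suc i) = begin
  w zero ℤ.* 0ℤ ℤ.+ sum (λ x → w (suc x) ℤ.* unit (suc i) (suc x))
    ≡⟨ cong₂ ℤ._+_ (ℤ.*-zeroʳ (w zero)) (sum-cong-≗ (λ x → cong (w (suc x) ℤ.*_) (unit-suc i x))) ⟩
  0ℤ ℤ.+ sum (λ x → w (suc x) ℤ.* unit i x) ≡⟨ ℤ.+-identityˡ _ ⟩
  sum (λ x → w (suc x) ℤ.* unit i x)        ≡⟨ sum-unit (λ x → w (suc x)) i ⟩
  w (suc i)                                 ∎
  where open ≡-Reasoning

dot-pt : ∀ {n} (w : Fin n → ℤ) i j → dot w (pt (i , j)) ≡ w i ℤ.+ w j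
dot-pt w i j = begin
  dot w (pt (i , j))                                            ≡⟨ dot≡sum w (pt (i , j)) ⟩
  sum (λ x → w x ℤ.* (unit i x ℤ.+ unit j x))                   ≡⟨ sum-cong-≗ distrib ⟩
  sum (λ x → wᵢ x ℤ.+ wⱼ x)                                     ≡⟨ ∑-distrib-+ wᵢ wⱼ ⟩
  sum (λ x → w x ℤ.* unit i x) ℤ.+ sum (λ x → w x ℤ.* unit j x) ≡⟨ cong₂ ℤ._+_ (sum-unit w i) (sum-unit w j) ⟩
  w i ℤ.+ w j                                                   ∎
  where
    open ≡-Reasoning
    wᵢ wⱼ : Fin _ → ℤ
    wᵢ x = w x ℤ.* unit i x
    wⱼ x = w x ℤ.* unit j x
    distrib : ∀ x → w x ℤ.* (unit i x ℤ.+ unit j x) ≡ wᵢ x ℤ.+ wⱼ x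
    distrib x = ℤ.*-distribˡ-+ (w x) (unit i x) (unit j x)

edgeBetween : ∀ {n} → Fin n → Fin n → Fin n × Fin n
edgeBetween x y with toℕ x <? toℕ y
... | yes _ = x , y
... | no _  = y , x

edgeBetween-injective : ∀ {n} {x y x′ y′ : Fin n} → edgeBetween x y ≡ edgeBetween x′ y′ →
                        (x ≡ x′ × y ≡ y′) ⊎ (x ≡ y′ × y ≡ x′)
edgeBetween-injective {x = x} {y} {x′} {y′} eq with toℕ x <? toℕ y | toℕ x′ <? toℕ y′
... | yes _ | yes _ = inj₁ (cong proj₁ eq , cong proj₂ eq)
... | yes _ | no _  = inj₂ (cong proj₁ eq , cong proj₂ eq)
... | no _  | yes _ = inj₂ (cong proj₂ eq , cong proj₁ eq)
... | no _  | no _  = inj₁ (cong proj₂ eq , cong proj₁ eq)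

dot-edgeBetween : ∀ {n} (w : Fin n → ℤ) x y → dot w (pt (edgeBetween x y)) ≡ w x ℤ.+ w y
dot-edgeBetween w x y with toℕ x <? toℕ y
... | yes _ = dot-pt w x y
... | no _  = trans (dot-pt w y x) (ℤ.+-comm (w y) (w x))

Adjacent : ∀ {n} → Graph n → Fin n → Fin n → Set
Adjacent G x y = adj G x y ≡ true

module _ {n} (G : Graph n) where

  ∈-edges⁻ : ∀ {i j} → (i , j) ∈ edges G → toℕ i < toℕ j × Adjacent G i j
  ∈-edges⁻ ij∈E
    with Equivalence.to T-∧ (proj₂ (∈-filter⁻ _ {xs = cartesianProduct (allFin n) (allFin n)} ij∈E))
  ... | i<ᵇj , ij∈G = <ᵇ⇒< _ _ i<ᵇj , Equivalence.to T-≡ ij∈G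

  ∈-edges⁺ : ∀ {i j} → toℕ i < toℕ j → Adjacent G i j → (i , j) ∈ edges G
  ∈-edges⁺ {i} {j} i<j ij∈G = ∈-filter⁺ _ (∈-cartesianProduct⁺ (∈-allFin i) (∈-allFin j))
    (Equivalence.from T-∧ (<⇒<ᵇ i<j , Equivalence.from T-≡ ij∈G))

  edgeBetween-∈ : ∀ {x y} → Adjacent G x y → edgeBetween x y ∈ edges G
  edgeBetween-∈ {x} {y} xy with toℕ x <? toℕ y
  ... | yes x<y = ∈-edges⁺ x<y xy
  ... | no x≮y  = ∈-edges⁺ (≤∧≢⇒< (≮⇒≥ x≮y) (loopless ∘ toℕ-injective)) (trans (symm G y x) xy)
    where
      loopless : y ≢ x
      loopless refl = contradiction (trans (sym xy) (irrefl G x)) λ ()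

  simpleCycle⇒hasCycle : ∀ {L} → 0 < L → SimpleCycle (Adjacent G) L → HasCycle G L
  simpleCycle⇒hasCycle {suc m} _ C =
    (λ k → vertex (toℕ k)) ,
    (λ eq → toℕ-injective (distinct (toℕ<n _) (toℕ<n _) eq)) ,
    (λ k → subst (λ i → Adjacent G (vertex i) (vertex (suc (toℕ k)))) (sym (toℕ-inject₁ k))
                 (step (m<n⇒m<1+n (toℕ<n k)))) ,
    subst (λ i → Adjacent G (vertex i) (vertex 0)) (sym (toℕ-fromℕ m))
          (subst (Adjacent G (vertex m)) closed (step ≤-refl))
    where open SimpleCycle C

  hasCycle⇒simpleCycle : ∀ {L} → HasCycle G L → SimpleCycle (Adjacent G) L
  hasCycle⇒simpleCycle {suc m} (f , f-injective , f-steps , f-closes) = record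
    { vertex   = vertex
    ; closed   = trans vertex-beyond (sym (vertex-toℕ zero refl))
    ; step     = step
    ; distinct = λ i<L j<L eq → fromℕ<-injective _ _ i<L j<L
                   (f-injective (trans (sym (vertex-fromℕ< i<L)) (trans eq (vertex-fromℕ< j<L))))
    }
    where
      vertex : ℕ → Fin n
      vertex i with i <? suc m
      ... | yes i<L = f (fromℕ< i<L)
      ... | no _    = f zero

      vertex-toℕ : ∀ {i} k → toℕ k ≡ i → vertex i ≡ f k
      vertex-toℕ {i} k refl with i <? suc m
      ... | yes k<L = cong f (fromℕ<-toℕ k k<L)
      ... | no k≮L  = contradiction (toℕ<n k) k≮L

      vertex-fromℕ< : ∀ {i} (i<L : i < suc m) → vertex i ≡ f (fromℕ< i<L)
      vertex-fromℕ< i<L = vertex-toℕ _ (toℕ-fromℕ< i<L)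

      vertex-beyond : vertex (suc m) ≡ f zero
      vertex-beyond with suc m <? suc m
      ... | yes m<m = contradiction m<m (<-irrefl refl)
      ... | no _    = refl

      step : ∀ {i} → i < suc m → Adjacent G (vertex i) (vertex (suc i))
      step {i} (s≤s i≤m) with m≤n⇒m<n∨m≡n i≤m
      ... | inj₁ i<m  = subst₂ (Adjacent G)
                          (sym (vertex-toℕ (inject₁ k) (trans (toℕ-inject₁ k) (toℕ-fromℕ< i<m))))
                          (sym (vertex-toℕ (suc k) (cong suc (toℕ-fromℕ< i<m)))) (f-steps k)
        where
          k : Fin m
          k = fromℕ< i<m
      ... | inj₂ refl = subst₂ (Adjacent G) (sym (vertex-toℕ (fromℕ m) (toℕ-fromℕ m))) (sym vertex-beyond)
                               f-closes

ℤ+-cancelˡ-< : ∀ k {i j} → k ℤ.+ i ℤ.< k ℤ.+ j → i ℤ.< j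
ℤ+-cancelˡ-< k k+i<k+j = ℤ.≰⇒> λ j≤i → ℤ.<⇒≱ k+i<k+j (ℤ.+-monoʳ-≤ k j≤i)

-- Neighborliness excludes short even cycles

module OddEdges {n} (G : Graph n) (J : ℕ) (2≤J : 2 ≤ J) (C : SimpleCycle (Adjacent G) (J + J)) where
  open SimpleCycle C

  oddEdge evenEdge : ℕ → Fin n × Fin n
  oddEdge  t = edgeBetween (vertex (t + t)) (vertex (suc (t + t)))
  evenEdge t = edgeBetween (vertex (suc (t + t))) (vertex (2 + (t + t)))

  oddEdges : List (Fin n × Fin n)
  oddEdges = applyUpTo oddEdge J

  odd-index : ∀ {t} → t < J → suc (t + t) < J + J
  odd-index {t} t<J = subst (_≤ J + J) (cong suc (+-suc t t)) (+-mono-≤ t<J t<J)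

  even-index : ∀ {t} → t < J → t + t < J + J
  even-index t<J = <-trans (n<1+n _) (odd-index t<J)

  oddEdge-∈ : ∀ {t} → t < J → oddEdge t ∈ edges G
  oddEdge-∈ t<J = edgeBetween-∈ G (step (even-index t<J))

  evenEdge-∈ : ∀ {t} → t < J → evenEdge t ∈ edges G
  evenEdge-∈ t<J = edgeBetween-∈ G (step (odd-index t<J))

  oddEdge-injective : ∀ {s t} → s < J → t < J → oddEdge s ≡ oddEdge t → s ≡ t
  oddEdge-injective {s} {t} s<J t<J eq with edgeBetween-injective eq
  ... | inj₁ (same , _) = double-injective (distinct (even-index s<J) (even-index t<J) same)
  ... | inj₂ (flip , _) =
    contradiction (distinct (even-index s<J) (odd-index t<J) flip) (double≢1+double s t)

  -- Here 2 ≤ J is needed: for J = 1 the even edge v₁v₂ = v₁v₀ is the odd edge v₀v₁.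
  evenEdge≢oddEdge : ∀ {s t} → s < J → t < J → evenEdge s ≢ oddEdge t
  evenEdge≢oddEdge {s} {t} s<J t<J eq with edgeBetween-injective eq
  ... | inj₁ (flip , _) = double≢1+double t s (sym (distinct (odd-index s<J) (even-index t<J) flip))
  ... | inj₂ (same , back)
    with double-injective {s} {t} (suc-injective (distinct (odd-index s<J) (odd-index t<J) same))
  ...   | refl = vertex-2+≢ C (≤-trans (s≤s (s≤s (s≤s z≤n))) (+-mono-≤ 2≤J 2≤J)) (odd-index s<J) back

  oddEdges-unique : Unique oddEdges
  oddEdges-unique = Unique.applyUpTo⁺₁ oddEdge J λ s<t t<J eq →
    <⇒≢ s<t (oddEdge-injective (<-trans s<t t<J) t<J eq)

  oddEdges-⊆ : All (_∈ edges G) oddEdges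
  oddEdges-⊆ = All.applyUpTo⁺₁ oddEdge J oddEdge-∈

  oddEdges-noFace : ¬ IsFaceVertexSet G oddEdges
  oddEdges-noFace (w , c , face) =
    ℤ.<-irrefl (cong w closed) (descending⇒< {_≺_ = ℤ._<_} ℤ.<-trans a J descent (<-trans z<s 2≤J))
    where
      a : ℕ → ℤ
      a t = w (vertex (t + t))

      descent : ∀ {t} → t < J → a (suc t) ℤ.< a t
      descent {t} t<J = begin-strict
        a (suc t)                ≡⟨ cong (w ∘ vertex ∘ suc) (+-suc t t) ⟩
        w (vertex (2 + (t + t))) <⟨ ℤ+-cancelˡ-< middle (begin-strict
          middle ℤ.+ w (vertex (2 + (t + t))) <⟨ belowFace ⟩
          c                                   ≡⟨ onFace ⟨
          a t ℤ.+ middle                      ≡⟨ ℤ.+-comm (a t) middle ⟩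
          middle ℤ.+ a t                      ∎) ⟩
        a t                      ∎
        where
          open ℤ.≤-Reasoning

          middle : ℤ
          middle = w (vertex (suc (t + t)))

          onFace : a t ℤ.+ middle ≡ c
          onFace = trans (sym (dot-edgeBetween w _ _))
                         (proj₁ (face (oddEdge t) (oddEdge-∈ t<J)) (∈-applyUpTo⁺ oddEdge t<J))

          notOdd : evenEdge t ∉ oddEdges
          notOdd even∈odd with ∈-applyUpTo⁻ oddEdge even∈odd
          ... | t′ , t′<J , eq = evenEdge≢oddEdge t<J t′<J eq

          belowFace : middle ℤ.+ w (vertex (2 + (t + t))) ℤ.< c
          belowFace = subst (ℤ._< c) (dot-edgeBetween w _ _)
                            (proj₂ (face (evenEdge t) (evenEdge-∈ t<J)) notOdd)

neighborly⇒evenCycleFree : ∀ {n} k (G : Graph n) → Neighborly k G → EvenCycleFree k G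
neighborly⇒evenCycleFree k G neighborly J 2≤J J≤k cycle =
  oddEdges-noFace (neighborly oddEdges oddEdges-unique oddEdges-⊆
                              (subst (_≤ k) (sym (length-applyUpTo oddEdge J)) J≤k))
  where open OddEdges G J 2≤J (hasCycle⇒simpleCycle G cycle)

-- Without short even cycles, few edges always span a face

endpoints : ∀ {A : Set} → List (A × A) → List A
endpoints S = map proj₁ S ++ map proj₂ S

length-endpoints : ∀ {A : Set} (S : List (A × A)) → length (endpoints S) ≡ length S + length S
length-endpoints S = trans (length-++ (map proj₁ S)) (cong₂ _+_ (length-map proj₁ S) (length-map proj₂ S))

module FaceConstruction {n} (G : Graph n) (colour : Fin n → Bool)
  (proper : ∀ x y → Adjacent G x y → colour x ≢ colour y)
  (S : List (Fin n × Fin n)) (S⊆E : All (_∈ edges G) S) where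

  open DecMembership (Product.≡-dec (Fin._≟_ {n}) (Fin._≟_ {n})) using (_∈?_)

  InS : Fin n → Fin n → Set
  InS x y = (x , y) ∈ S ⊎ (y , x) ∈ S

  OffS : Fin n → Fin n → Set
  OffS x y = Adjacent G x y × colour x ≡ true × ¬ InS x y

  inS? : Decidable InS
  inS? x y = ((x , y) ∈? S) ⊎-dec ((y , x) ∈? S)

  offS? : Decidable OffS
  offS? x y = (adj G x y Bool.≟ true) ×-dec (colour x Bool.≟ true) ×-dec ¬? (inS? x y)

  open Potentials inS? offS?

  InS-sym : ∀ {x y} → InS x y → InS y x
  InS-sym = Sum.swap

  InS-adjacent : ∀ {x y} → InS x y → Adjacent G x y
  InS-adjacent (inj₁ xy∈S) = proj₂ (∈-edges⁻ G (All.lookup S⊆E xy∈S))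
  InS-adjacent (inj₂ yx∈S) = trans (symm G _ _) (proj₂ (∈-edges⁻ G (All.lookup S⊆E yx∈S)))

  InS-endpoint : ∀ {x y} → InS x y → x ∈ endpoints S × y ∈ endpoints S
  InS-endpoint (inj₁ xy∈S) = ∈-++⁺ˡ (∈-map⁺ proj₁ xy∈S) , ∈-++⁺ʳ (map proj₁ S) (∈-map⁺ proj₂ xy∈S)
  InS-endpoint (inj₂ yx∈S) = ∈-++⁺ʳ (map proj₁ S) (∈-map⁺ proj₂ yx∈S) , ∈-++⁺ˡ (∈-map⁺ proj₁ yx∈S)

  arc⇒adjacent : ∀ {x y} → Arc x y → Adjacent G x y
  arc⇒adjacent (inj₁ inS)  = InS-adjacent inS
  arc⇒adjacent (inj₂ offS) = proj₁ offS

  arc-from-false : ∀ {x y} → Arc x y → colour x ≡ false → InS x y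
  arc-from-false (inj₁ inS)           _   = inS
  arc-from-false (inj₂ (_ , cx , _)) cx′ = contradiction (trans (sym cx) cx′) λ ()

  arc-into-true : ∀ {x y} → Arc x y → colour y ≡ true → InS x y
  arc-into-true (inj₁ inS)            _  = inS
  arc-into-true (inj₂ (xy , cx , _)) cy = contradiction (trans cx (sym cy)) (proper _ _ xy)

  offS-irreversible : ∀ {x y} → OffS x y → ¬ Arc y x
  offS-irreversible (_ , _ , notInS) (inj₁ inS)          = notInS (InS-sym inS)
  offS-irreversible (xy , cx , _)    (inj₂ (_ , cy , _)) = proper _ _ xy (trans cx (sym cy))

  module _ (P : Potential) where
    open Potential P

    weight : Fin n → ℤ
    weight x = if colour x then ℤ.- (ℤ.+ height x) else ℤ.+ height x

    weight-sum : ∀ {x y} → colour x ≡ true → Adjacent G x y →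
                 weight x ℤ.+ weight y ≡ height y ℤ.⊖ height x
    weight-sum {x} {y} cx xy with colour y in cy
    ... | true  = contradiction (trans cx (sym cy)) (proper x y xy)
    ... | false rewrite cx = ℤ.-m+n≡n⊖m (height x) (height y)

    oriented-edge-weight : ∀ {x y} → colour x ≡ true → Adjacent G x y →
      (InS x y → weight x ℤ.+ weight y ≡ 0ℤ) × (¬ InS x y → weight x ℤ.+ weight y ℤ.< 0ℤ)
    oriented-edge-weight {x} {y} cx xy =
      (λ inS → trans (weight-sum cx xy) (balanced inS)) ,
      (λ notInS → subst (ℤ._< 0ℤ) (sym (weight-sum cx xy)) (descending (xy , cx , notInS)))
      where
        balanced : InS x y → height y ℤ.⊖ height x ≡ 0ℤ
        balanced inS rewrite ≤-antisym (weak-≤ inS) (weak-≤ (InS-sym inS)) = ℤ.n⊖n≡0 (height x)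

        descending : OffS x y → height y ℤ.⊖ height x ℤ.< 0ℤ
        descending offS = subst (height y ℤ.⊖ height x ℤ.<_) (ℤ.n⊖n≡0 (height x))
                                (ℤ.⊖-monoˡ-< (height x) (strict-< offS))

    edge-weight : ∀ {x y} → Adjacent G x y →
      (InS x y → weight x ℤ.+ weight y ≡ 0ℤ) × (¬ InS x y → weight x ℤ.+ weight y ℤ.< 0ℤ)
    edge-weight {x} {y} xy with colour x Bool.≟ true
    ... | yes cx = oriented-edge-weight cx xy
    ... | no ¬cx =
      (λ inS → trans (ℤ.+-comm (weight x) (weight y)) (proj₁ swapped (InS-sym inS))) ,
      (λ notInS → subst (ℤ._< 0ℤ) (ℤ.+-comm (weight y) (weight x)) (proj₂ swapped (notInS ∘ InS-sym)))
      where
        cy : colour y ≡ true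
        cy = trans (¬-not (≢-sym (proper x y xy))) (cong not (¬-not ¬cx))

        swapped : (InS y x → weight y ℤ.+ weight x ≡ 0ℤ) × (¬ InS y x → weight y ℤ.+ weight x ℤ.< 0ℤ)
        swapped = oriented-edge-weight cy (trans (symm G y x) xy)

    potential⇒face : IsFaceVertexSet G S
    potential⇒face = weight , 0ℤ , onEdge
      where
        onEdge : ∀ e → e ∈ edges G → (e ∈ S → dot weight (pt e) ≡ 0ℤ) × (e ∉ S → dot weight (pt e) ℤ.< 0ℤ)
        onEdge (i , j) e∈E with ∈-edges⁻ G e∈E
        ... | i<j , ij =
          (λ e∈S → trans (dot-pt weight i j) (proj₁ (edge-weight ij) (inj₁ e∈S))) ,
          (λ e∉S → subst (ℤ._< 0ℤ) (sym (dot-pt weight i j)) (proj₂ (edge-weight ij) [ e∉S , reversed∉S ]))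
          where
            reversed∉S : (j , i) ∉ S
            reversed∉S ji∈S = <-asym i<j (proj₁ (∈-edges⁻ G (All.lookup S⊆E ji∈S)))

  offS⇒2≤J : ∀ J (C : SimpleCycle Arc (J + J)) {i} → i < J + J →
             OffS (SimpleCycle.vertex C i) (SimpleCycle.vertex C (suc i)) → 2 ≤ J
  offS⇒2≤J zero          _ ()  _
  offS⇒2≤J (suc zero)    C i<2 offS = contradiction (reverseStep C i<2) (offS-irreversible offS)
  offS⇒2≤J (suc (suc J)) _ _   _    = s≤s (s≤s z≤n)

  strictCycle⇒evenCycle : StrictCycle → ∃ λ J → 2 ≤ J × J ≤ length S × HasCycle G (J + J)
  strictCycle⇒evenCycle record { len = L ; cycle = C ; strictStep = i , i<L , offS }
    with alternating⇒even (colour ∘ vertex) alternates (cong colour closed)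
    where
      open SimpleCycle C

      alternates : ∀ {i} → i < L → colour (vertex (suc i)) ≡ not (colour (vertex i))
      alternates i<L = ¬-not (≢-sym (proper _ _ (arc⇒adjacent (step i<L))))
  ... | J , refl = J , 2≤J , J≤|S| , simpleCycle⇒hasCycle G (<-≤-trans z<s i<L) (mapCycle arc⇒adjacent C)
    where
      open SimpleCycle C

      covered : ∀ {i} → i < J + J → vertex i ∈ endpoints S
      covered {i} i<L with colour (vertex i) Bool.≟ true
      ... | yes ci = proj₂ (InS-endpoint (arc-into-true (proj₂ (incomingStep C i<L)) ci))
      ... | no ¬ci = proj₁ (InS-endpoint (arc-from-false (step i<L) (¬-not ¬ci)))

      J≤|S| : J ≤ length S
      J≤|S| = double-cancel-≤ (subst (J + J ≤_) (length-endpoints S)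
                                     (injectiveBelow⇒≤length vertex distinct covered))

      2≤J : 2 ≤ J
      2≤J = offS⇒2≤J J C i<L offS

  face⊎shortEvenCycle : IsFaceVertexSet G S ⊎ ∃ λ J → 2 ≤ J × J ≤ length S × HasCycle G (J + J)
  face⊎shortEvenCycle = Sum.map potential⇒face strictCycle⇒evenCycle potential⊎strictCycle

evenCycleFree⇒neighborly : ∀ {n} k (G : Graph n) → Bipartite G → EvenCycleFree k G → Neighborly k G
evenCycleFree⇒neighborly k G (colour , proper) evenCycleFree S _ S⊆E |S|≤k =
  [ id , (λ (J , 2≤J , J≤|S| , cycle) → ⊥-elim (evenCycleFree J 2≤J (≤-trans J≤|S| |S|≤k) cycle)) ]
  (FaceConstruction.face⊎shortEvenCycle G colour proper S S⊆E)

corollary4p2 : (k n : ℕ) → 2 ≤ k → (G : Graph n) → NoIsolated G → Bipartite G →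
    k ≤ length (edges G) → (Neighborly k G ⇔ EvenCycleFree k G)
corollary4p2 k n _ G _ bipartite _ =
  mk⇔ (neighborly⇒evenCycleFree k G) (evenCycleFree⇒neighborly k G bipartite)
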